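{- Let $\mathbb{L}$ be an $\mathcal{L}$-algebra, $F$ a filter of $\mathbb{L}$ and $J$ an ideal of $\mathbb{L}$. Then (1) $F\cap\Box J\neq\emptyset$ if and only if $F\cap\lceil\Box J\rceil\neq\emptyset$; (2) $\Diamond F\cap J\neq\emptyset$ if and only if $\lfloor\Diamond F\rfloor\cap J\neq\emptyset$.
   Context: An $\mathcal{L}$-algebra is a bounded lattice $(L,\wedge,\vee,\top,\bot)$ with unary operations $\Box,\Diamond$ satisfying $\Box\top=\top$, $\Box(a\wedge b)=\Box a\wedge\Box b$, $\Diamond\bot=\bot$, $\Diamond(a\vee b)=\Diamond a\vee\Diamond b$. For $K\subseteq L$: $\Box K=\{\Box u\mid u\in K\}$, $\Diamond K=\{\Diamond v\mid v\in K\}$, $\lceil K\rceil$ is the ideal generated by $K$ and $\lfloor K\rfloor$ the filter generated by $K$. -}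

module Defs where

open import Level using (Level; _⊔_; suc)
open import Algebra.Core using (Op₁; Op₂)
open import Algebra.Definitions using (Identity; Congruent₁)
open import Algebra.Lattice.Bundles using (Lattice)
open import Data.Product using (Σ; ∃; _×_)
open import Relation.Binary.Core using (Rel)

record LAlgebra (c ℓ : Level) : Set (suc (c ⊔ ℓ)) where
  field
    lattice : Lattice c ℓ
  open Lattice lattice public
  field
    ⊤ : Carrier
    ⊥ : Carrier
    ∧-identity : Identity _≈_ ⊤ _∧_
    ∨-identity : Identity _≈_ ⊥ _∨_
    □ : Op₁ Carrier
    ◇ : Op₁ Carrier
    □-cong : Congruent₁ _≈_ □
    ◇-cong : Congruent₁ _≈_ ◇
    □-⊤ : □ ⊤ ≈ ⊤
    □-∧ : ∀ a b → □ (a ∧ b) ≈ □ a ∧ □ b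
    ◇-⊥ : ◇ ⊥ ≈ ⊥
    ◇-∨ : ∀ a b → ◇ (a ∨ b) ≈ ◇ a ∨ ◇ b

  _≤_ : Rel Carrier ℓ
  x ≤ y = (x ∧ y) ≈ x

module _ {c ℓ : Level} (L : LAlgebra c ℓ) where
  open LAlgebra L

  Subset : (p : Level) → Set (c ⊔ suc p)
  Subset p = Carrier → Set p

  record IsFilter {p : Level} (F : Subset p) : Set (c ⊔ ℓ ⊔ p) where
    field
      ⊤∈    : F ⊤
      up    : ∀ {x y} → x ≤ y → F x → F y
      ∧-closed : ∀ {x y} → F x → F y → F (x ∧ y)

  record IsIdeal {p : Level} (J : Subset p) : Set (c ⊔ ℓ ⊔ p) where
    field
      ⊥∈    : J ⊥
      down  : ∀ {x y} → x ≤ y → J y → J x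
      ∨-closed : ∀ {x y} → J x → J y → J (x ∨ y)

  □[_] : {p : Level} → Subset p → Subset (c ⊔ ℓ ⊔ p)
  □[ K ] x = ∃ λ u → K u × (x ≈ □ u)

  ◇[_] : {p : Level} → Subset p → Subset (c ⊔ ℓ ⊔ p)
  ◇[ K ] x = ∃ λ v → K v × (x ≈ ◇ v)

  data ⌈_⌉ {p : Level} (K : Subset p) : Subset (c ⊔ ℓ ⊔ p) where
    gen  : ∀ {x} → K x → ⌈ K ⌉ x
    bot  : ⌈ K ⌉ ⊥
    down : ∀ {x y} → x ≤ y → ⌈ K ⌉ y → ⌈ K ⌉ x
    join : ∀ {x y} → ⌈ K ⌉ x → ⌈ K ⌉ y → ⌈ K ⌉ (x ∨ y)

  data ⌊_⌋ {p : Level} (K : Subset p) : Subset (c ⊔ ℓ ⊔ p) where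
    gen  : ∀ {x} → K x → ⌊ K ⌋ x
    top  : ⌊ K ⌋ ⊤
    up   : ∀ {x y} → x ≤ y → ⌊ K ⌋ x → ⌊ K ⌋ y
    meet : ∀ {x y} → ⌊ K ⌋ x → ⌊ K ⌋ y → ⌊ K ⌋ (x ∧ y)

  -- A ∩ B ≠ ∅  (constructively: the intersection is inhabited)
  Meets : {p q : Level} → Subset p → Subset q → Set (c ⊔ p ⊔ q)
  Meets A B = ∃ λ x → A x × B x

-- Every element of the ideal generated by □J lies below □u for a single
-- u ∈ J, because ⊥ ≤ □⊥ and □ is monotone, so a join □u ∨ □v stays
-- below □(u ∨ v) with u ∨ v ∈ J.  If the filter F meets ⌈□J⌉ at x ≤ □u, it
-- therefore already contains □u ∈ □J.  Dually, every element of ⌊◇F⌋ lies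
-- above ◇v for some v ∈ F, and the ideal J is closed downward.
module Submission where

open import Defs
open import Level using (Level)
open import Data.Product using (_×_; _,_; proj₁; proj₂; ∃)
open import Function.Bundles using (_⇔_; mk⇔)
import Algebra.Lattice.Properties.Lattice as LatticeProperties
import Relation.Binary.Lattice as OrderLattice

module _ {c ℓ : Level} (L : LAlgebra c ℓ) where
  open LAlgebra L
  open OrderLattice.Lattice (LatticeProperties.∨-∧-orderTheoreticLattice lattice)
    using (x≤x∨y; y≤x∨y; ∨-least; x∧y≤x; x∧y≤y; ∧-greatest)
    renaming (_≤_ to _⊑_; refl to ⊑-refl; reflexive to ⊑-reflexive; trans to ⊑-trans; antisym to ⊑-antisym)

  -- The library order is x ≈ x ∧ y, the order of Defs is x ∧ y ≈ x.
  ≤⇒⊑ : ∀ {x y} → x ≤ y → x ⊑ y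
  ≤⇒⊑ = sym

  ⊑⇒≤ : ∀ {x y} → x ⊑ y → x ≤ y
  ⊑⇒≤ = sym

  ⊥-minimum : ∀ y → ⊥ ⊑ y
  ⊥-minimum y = ⊑-trans (x≤x∨y ⊥ y) (⊑-reflexive (proj₁ ∨-identity y))

  ⊤-maximum : ∀ y → y ⊑ ⊤
  ⊤-maximum y = ⊑-trans (⊑-reflexive (sym (proj₂ ∧-identity y))) (x∧y≤y y ⊤)

  □-monotone : ∀ {u v} → u ⊑ v → □ u ⊑ □ v
  □-monotone {u} {v} u⊑v =
    ⊑-trans (⊑-reflexive (□-cong u⊑v)) (⊑-trans (⊑-reflexive (□-∧ u v)) (x∧y≤y (□ u) (□ v)))

  ◇-monotone : ∀ {u v} → u ⊑ v → ◇ u ⊑ ◇ v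
  ◇-monotone {u} {v} u⊑v =
    ⊑-trans (x≤x∨y (◇ u) (◇ v)) (⊑-reflexive (trans (sym (◇-∨ u v)) (◇-cong u∨v≈v)))
    where
    u∨v≈v : u ∨ v ≈ v
    u∨v≈v = ⊑-antisym (∨-least u⊑v ⊑-refl) (y≤x∨y u v)

  module _ {q : Level} {J : Subset L q} (J-ideal : IsIdeal L J) where
    open IsIdeal J-ideal using (⊥∈; ∨-closed)

    ⌈□⌉-below-□ : ∀ {x} → ⌈_⌉ L (□[_] L J) x → ∃ λ u → J u × x ⊑ □ u
    ⌈□⌉-below-□ (gen (u , Ju , x≈□u)) = u , Ju , ⊑-reflexive x≈□u
    ⌈□⌉-below-□ bot = ⊥ , ⊥∈ , ⊥-minimum (□ ⊥)
    ⌈□⌉-below-□ (down x≤y y∈) with ⌈□⌉-below-□ y∈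
    ... | u , Ju , y⊑□u = u , Ju , ⊑-trans (≤⇒⊑ x≤y) y⊑□u
    ⌈□⌉-below-□ (join x∈ y∈) with ⌈□⌉-below-□ x∈ | ⌈□⌉-below-□ y∈
    ... | u , Ju , x⊑□u | v , Jv , y⊑□v =
      u ∨ v , ∨-closed Ju Jv ,
      ∨-least (⊑-trans x⊑□u (□-monotone (x≤x∨y u v)))
              (⊑-trans y⊑□v (□-monotone (y≤x∨y u v)))

  module _ {p : Level} {F : Subset L p} (F-filter : IsFilter L F) where
    open IsFilter F-filter using (⊤∈; ∧-closed)

    ⌊◇⌋-above-◇ : ∀ {x} → ⌊_⌋ L (◇[_] L F) x → ∃ λ v → F v × ◇ v ⊑ x
    ⌊◇⌋-above-◇ (gen (v , Fv , x≈◇v)) = v , Fv , ⊑-reflexive (sym x≈◇v)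
    ⌊◇⌋-above-◇ top = ⊤ , ⊤∈ , ⊤-maximum (◇ ⊤)
    ⌊◇⌋-above-◇ (up x≤y x∈) with ⌊◇⌋-above-◇ x∈
    ... | v , Fv , ◇v⊑x = v , Fv , ⊑-trans ◇v⊑x (≤⇒⊑ x≤y)
    ⌊◇⌋-above-◇ (meet x∈ y∈) with ⌊◇⌋-above-◇ x∈ | ⌊◇⌋-above-◇ y∈
    ... | u , Fu , ◇u⊑x | v , Fv , ◇v⊑y =
      u ∧ v , ∧-closed Fu Fv ,
      ∧-greatest (⊑-trans (◇-monotone (x∧y≤x u v)) ◇u⊑x)
                 (⊑-trans (◇-monotone (x∧y≤y u v)) ◇v⊑y)

  module _ {p q : Level} {F : Subset L p} {J : Subset L q}
           (F-filter : IsFilter L F) (J-ideal : IsIdeal L J) where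

    meets-□⇔meets-⌈□⌉ : Meets L F (□[_] L J) ⇔ Meets L F (⌈_⌉ L (□[_] L J))
    meets-□⇔meets-⌈□⌉ = mk⇔ (λ (x , Fx , x∈□J) → x , Fx , gen x∈□J) from
      where
      from : Meets L F (⌈_⌉ L (□[_] L J)) → Meets L F (□[_] L J)
      from (x , Fx , x∈) with ⌈□⌉-below-□ J-ideal x∈
      ... | u , Ju , x⊑□u = □ u , IsFilter.up F-filter (⊑⇒≤ x⊑□u) Fx , u , Ju , refl

    meets-◇⇔meets-⌊◇⌋ : Meets L (◇[_] L F) J ⇔ Meets L (⌊_⌋ L (◇[_] L F)) J
    meets-◇⇔meets-⌊◇⌋ = mk⇔ (λ (x , x∈◇F , Jx) → x , gen x∈◇F , Jx) from
      where
      from : Meets L (⌊_⌋ L (◇[_] L F)) J → Meets L (◇[_] L F) J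
      from (x , x∈ , Jx) with ⌊◇⌋-above-◇ F-filter x∈
      ... | v , Fv , ◇v⊑x = ◇ v , (v , Fv , refl) , IsIdeal.down J-ideal (⊑⇒≤ ◇v⊑x) Jx

lemma6 : {c ℓ p q : Level} (L : LAlgebra c ℓ) (F : Subset L p) (J : Subset L q) →
    IsFilter L F → IsIdeal L J →
    (Meets L F (□[_] L J) ⇔ Meets L F (⌈_⌉ L (□[_] L J)))
    × (Meets L (◇[_] L F) J ⇔ Meets L (⌊_⌋ L (◇[_] L F)) J)
lemma6 L F J F-filter J-ideal =
  meets-□⇔meets-⌈□⌉ L F-filter J-ideal , meets-◇⇔meets-⌊◇⌋ L F-filter J-ideal
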